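{- For $n\ge1$ let $\mathcal{S}_n=\{A+A : A\subseteq \mathbb{F}_2^n\}$, where $A+A=\{a+b: a,b\in A\}$, and let $\mathcal{H}_n=\{S\subseteq \mathbb{F}_2^n : \exists\, v\in\mathbb{F}_2^n \text{ with } v^\perp\subseteq S\}$. Then $|\mathcal{H}_n\setminus \mathcal{S}_n| = o(|\mathcal{H}_n|)$ as $n\to\infty$.
   Context: $v^\perp=\{x\in\mathbb{F}_2^n : \langle x,v\rangle=0\}$ with the standard bilinear form over $\mathbb{F}_2$. In $A+A$ the sums $a+a$ are included. -}

module Defs where

open import Data.Bool using (Bool; true; false; _xor_; _∧_)
open import Data.Bool.Properties using () renaming (_≟_ to _≟B_)
open import Data.Nat using (ℕ; zero; suc)
open import Data.Vec using (Vec; []; _∷_; zipWith; foldr)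
open import Data.List using (List; []; _∷_; _++_; map; cartesianProduct; filter; length)
open import Data.List.Membership.Propositional using (_∈_; lose)
open import Data.List.Membership.Propositional.Properties
  using (∈-++⁺ˡ; ∈-++⁺ʳ; ∈-map⁺; ∈-cartesianProduct⁺)
open import Data.List.Relation.Unary.Any using (Any; here; there; any?; satisfied)
open import Data.List.Relation.Unary.All as All using (All; all?)
open import Data.Product using (Σ; _×_; _,_; proj₁; proj₂)
open import Data.Product.Properties using (≡-dec)
open import Function.Bundles using (_⇔_; mk⇔)
import Function.Bundles
open import Relation.Binary.PropositionalEquality using (_≡_; refl)
open import Relation.Binary.Definitions using (DecidableEquality)
open import Relation.Nullary using (Dec; yes; no; ¬_)
open import Relation.Nullary.Decidable using (_×-dec_; _→-dec_; map′)
open import Relation.Unary using (Pred; Decidable)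
open import Level using (0ℓ)

F₂^ : ℕ → Set
F₂^ n = Vec Bool n

_⊕_ : ∀ {n} → F₂^ n → F₂^ n → F₂^ n
_⊕_ = zipWith _xor_

⟨_,_⟩ : ∀ {n} → F₂^ n → F₂^ n → Bool
⟨ x , v ⟩ = foldr _ _xor_ false (zipWith _∧_ x v)

allVecs : (n : ℕ) → List (F₂^ n)
allVecs zero    = [] ∷ []
allVecs (suc n) = map (true ∷_) (allVecs n) ++ map (false ∷_) (allVecs n)

allVecs-complete : ∀ {n} (x : F₂^ n) → x ∈ allVecs n
allVecs-complete []          = here refl
allVecs-complete {suc n} (true ∷ x)  = ∈-++⁺ˡ (∈-map⁺ (true ∷_) (allVecs-complete x))
allVecs-complete {suc n} (false ∷ x) =
  ∈-++⁺ʳ (map (true ∷_) (allVecs n)) (∈-map⁺ (false ∷_) (allVecs-complete x))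

-- Subsets of F₂ⁿ, represented by their characteristic function stored
-- as a complete binary tree of depth n (so that two subsets are equal
-- iff they have the same elements, and equality is decidable).

Subset : ℕ → Set
Subset zero    = Bool
Subset (suc n) = Subset n × Subset n

member : ∀ {n} → Subset n → F₂^ n → Bool
member b             []          = b
member (St , Sf)     (true ∷ x)  = member St x
member (St , Sf)     (false ∷ x) = member Sf x

_∈ₛ_ : ∀ {n} → F₂^ n → Subset n → Set
x ∈ₛ S = member S x ≡ true

_≟ₛ_ : ∀ {n} → DecidableEquality (Subset n)
_≟ₛ_ {zero}  = _≟B_
_≟ₛ_ {suc n} = ≡-dec _≟ₛ_ _≟ₛ_

allSubsets : (n : ℕ) → List (Subset n)
allSubsets zero    = true ∷ false ∷ []
allSubsets (suc n) = cartesianProduct (allSubsets n) (allSubsets n)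

allSubsets-complete : ∀ {n} (S : Subset n) → S ∈ allSubsets n
allSubsets-complete {zero} true  = here refl
allSubsets-complete {zero} false = there (here refl)
allSubsets-complete {suc n} (St , Sf) =
  ∈-cartesianProduct⁺ (allSubsets-complete St) (allSubsets-complete Sf)

module _ {A : Set} (xs : List A) (complete : ∀ x → x ∈ xs) where
  ∃-dec : {P : Pred A 0ℓ} → Decidable P → Dec (Σ A P)
  ∃-dec P? with any? P? xs
  ... | yes p = yes (satisfied p)
  ... | no ¬p = no λ { (x , px) → ¬p (lose (complete x) px) }

  ∀-dec : {P : Pred A 0ℓ} → Decidable P → Dec (∀ x → P x)
  ∀-dec P? with all? P? xs
  ... | yes p = yes λ x → All.lookup p (complete x)
  ... | no ¬p = no λ f → ¬p (All.tabulate (λ {x} _ → f x))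

_⇔-dec_ : {A B : Set} → Dec A → Dec B → Dec (A ⇔ B)
yes a ⇔-dec yes b = yes (mk⇔ (λ _ → b) (λ _ → a))
yes a ⇔-dec no ¬b = no λ e → ¬b (Function.Bundles.Equivalence.to e a)
no ¬a ⇔-dec yes b = no λ e → ¬a (Function.Bundles.Equivalence.from e b)
no ¬a ⇔-dec no ¬b = yes (mk⇔ (λ a → ⊥-e (¬a a)) (λ b → ⊥-e (¬b b)))
  where
  open import Data.Empty using (⊥-elim)
  ⊥-e : ∀ {C : Set} → _ → C
  ⊥-e = ⊥-elim

_∈A+A_ : ∀ {n} → F₂^ n → Subset n → Set
_∈A+A_ {n} x A = Σ (F₂^ n) λ a → Σ (F₂^ n) λ b → (a ∈ₛ A) × (b ∈ₛ A) × (a ⊕ b ≡ x)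

In𝒮 : ∀ {n} → Subset n → Set
In𝒮 {n} S = Σ (Subset n) λ A → ∀ (x : F₂^ n) → (x ∈ₛ S) ⇔ (x ∈A+A A)

perp⊆ : ∀ {n} → F₂^ n → Subset n → Set
perp⊆ {n} v S = ∀ (x : F₂^ n) → ⟨ x , v ⟩ ≡ false → x ∈ₛ S

Inℋ : ∀ {n} → Subset n → Set
Inℋ {n} S = Σ (F₂^ n) λ v → perp⊆ v S

∈ₛ-dec : ∀ {n} (x : F₂^ n) (S : Subset n) → Dec (x ∈ₛ S)
∈ₛ-dec x S = member S x ≟B true

∈A+A-dec : ∀ {n} (x : F₂^ n) (A : Subset n) → Dec (x ∈A+A A)
∈A+A-dec {n} x A =
  ∃-dec (allVecs n) allVecs-complete λ a →
  ∃-dec (allVecs n) allVecs-complete λ b →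
  ∈ₛ-dec a A ×-dec (∈ₛ-dec b A ×-dec Data.Vec.Properties.≡-dec _≟B_ (a ⊕ b) x)
  where import Data.Vec.Properties

In𝒮? : ∀ {n} → Decidable (In𝒮 {n})
In𝒮? {n} S = ∃-dec (allSubsets n) allSubsets-complete λ A →
  ∀-dec (allVecs n) allVecs-complete λ x → ∈ₛ-dec x S ⇔-dec ∈A+A-dec x A

Inℋ? : ∀ {n} → Decidable (Inℋ {n})
Inℋ? {n} S = ∃-dec (allVecs n) allVecs-complete λ v →
  ∀-dec (allVecs n) allVecs-complete λ x → (⟨ x , v ⟩ ≟B false) →-dec ∈ₛ-dec x S

Inℋ∖𝒮 : ∀ {n} → Subset n → Set
Inℋ∖𝒮 S = Inℋ S × ¬ In𝒮 S

Inℋ∖𝒮? : ∀ {n} → Decidable (Inℋ∖𝒮 {n})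
Inℋ∖𝒮? S = Inℋ? S ×-dec (In𝒮? S →-dec no (λ ()))

countSubsets : ∀ n {P : Pred (Subset n) 0ℓ} → Decidable P → ℕ
countSubsets n P? = length (filter P? (allSubsets n))

#ℋ : ℕ → ℕ
#ℋ n = countSubsets n (Inℋ? {n})

#ℋ∖𝒮 : ℕ → ℕ
#ℋ∖𝒮 n = countSubsets n (Inℋ∖𝒮? {n})

{-# OPTIONS --safe #-}
module Submission where

-- Every S ∈ ℋₙ with v^⊥ ⊆ S is v^⊥ ∪ T for T = S ∖ v^⊥, which lies in the coset ⟨x,v⟩ = 1.
-- Taking A = {0} ∪ T gives A + A = S unless some h ∈ v^⊥ has T ∩ (T + h) = ∅, i.e. T is
-- h-free.  Inside the h-invariant coset (2ⁿ⁻¹ points, split into pairs {x, x + h}) there are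
-- at most 3^(2ⁿ⁻²) h-free sets, so |ℋₙ ∖ 𝒮ₙ| ≤ 4ⁿ 3^(2ⁿ⁻²), while already the sets containing
-- the hyperplane x₀ = 0 give |ℋₙ| ≥ 2^(2ⁿ⁻¹) = 4^(2ⁿ⁻²).

open import Defs
open import Algebra.Bundles using (CommutativeRing)
open import Data.Bool using (Bool; true; false; not; _∧_; _xor_; if_then_else_)
open import Data.Bool.Properties
  using (xor-assoc; xor-identityˡ; xor-identityʳ; xor-same; ∧-distribʳ-xor; xor-∧-commutativeRing)
  renaming (_≟_ to _≟B_)
open import Data.Empty using (⊥)
open import Data.List
  using (List; []; _∷_; _++_; [_]; map; filter; length; concatMap; cartesianProductWith)
open import Data.List.Membership.Propositional using (_∈_; lose)
open import Data.List.Membership.Propositional.Properties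
  using (∈-∃++; ∈-++⁻; ∈-++⁺ˡ; ∈-++⁺ʳ; ∈-map⁺; ∈-map⁻; ∈-filter⁺; ∈-filter⁻;
         ∈-cartesianProductWith⁺; ∈-concatMap⁺)
open import Data.List.Properties using (length-++; length-map; length-filter)
open import Data.List.Relation.Binary.Subset.Propositional using (_⊆_)
open import Data.List.Relation.Unary.All as All using ()
open import Data.List.Relation.Unary.AllPairs using ([]; _∷_)
open import Data.List.Relation.Unary.Any using (here; there)
open import Data.List.Relation.Unary.Unique.Propositional using (Unique)
import Data.List.Relation.Unary.Unique.Propositional.Properties as Unique
open import Data.Nat
  using (ℕ; zero; suc; _+_; _*_; _^_; _≤_; _<_; z≤n; s≤s; _≤′_; ≤′-refl; ≤′-step)
open import Data.Nat.Properties
open import Data.Nat.Tactic.RingSolver using (solve-∀)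
open import Data.Product using (_×_; _,_; proj₁; proj₂; swap; ∃-syntax; ∃₂)
open import Data.Sum using (_⊎_; inj₁; inj₂)
open import Data.Unit using (tt)
open import Data.Vec using ([]; _∷_; replicate)
open import Data.Vec.Properties using (zipWith-assoc; zipWith-identityˡ; zipWith-identityʳ)
open import Function using (id)
open import Function.Bundles using (mk⇔)
open import Level using (0ℓ)
open import Relation.Binary.PropositionalEquality
  using (_≡_; _≢_; refl; sym; trans; cong; cong₂; subst; module ≡-Reasoning)
open import Relation.Nullary using (¬_; Dec; yes; no; ¬?; contradiction)
open import Relation.Nullary.Decidable using (_×-dec_; _→-dec_; decidable-stable)
open import Relation.Unary using (Pred; Decidable)

open import Algebra.Properties.CommutativeSemigroup +-commutativeSemigroup
  using () renaming (interchange to +-interchange)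
open import Algebra.Properties.CommutativeSemigroup *-commutativeSemigroup
  using () renaming (interchange to *-interchange)
open import Algebra.Properties.CommutativeSemigroup
  (CommutativeRing.+-commutativeSemigroup xor-∧-commutativeRing)
  using () renaming (interchange to xor-interchange)

2*m≡m+m : ∀ a → 2 * a ≡ a + a
2*m≡m+m a = cong (a +_) (+-identityʳ a)

^-double : ∀ b e → b ^ (2 * e) ≡ b ^ e * b ^ e
^-double b e = trans (cong (b ^_) (2*m≡m+m e)) (^-distribˡ-+-* b e e)

*-≤-^-+ : ∀ {b x y} m n → x ≤ b ^ m → y ≤ b ^ n → x * y ≤ b ^ (m + n)
*-≤-^-+ {b} m n x≤ y≤ = ≤-trans (*-mono-≤ x≤ y≤) (≤-reflexive (sym (^-distribˡ-+-* b m n)))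

m*m≤n*n⇒m≤n : ∀ {a b} → a * a ≤ b * b → a ≤ b
m*m≤n*n⇒m≤n a²≤b² = ≮⇒≥ λ b<a → <⇒≱ (*-mono-< b<a b<a) a²≤b²

n<2^n : ∀ n → n < 2 ^ n
n<2^n zero    = s≤s z≤n
n<2^n (suc n) = begin
  suc (suc n) ≡⟨ +-comm 1 (suc n) ⟩
  suc n + 1   ≤⟨ +-mono-≤ (n<2^n n) (m^n>0 2 n) ⟩
  2 ^ n + 2 ^ n ≡⟨ 2*m≡m+m (2 ^ n) ⟨
  2 ^ suc n   ∎
  where open ≤-Reasoning

squaring-≤ : ∀ (f g : ℕ → ℕ) → (∀ m → f (suc m) ≤ f m * f m) → (∀ m → g (suc m) ≡ g m * g m) →
             ∀ {m₀ m} → f m₀ ≤ g m₀ → m₀ ≤′ m → f m ≤ g m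
squaring-≤ f g f-step g-step base ≤′-refl                 = base
squaring-≤ f g f-step g-step base (≤′-step {m} m₀≤m) = begin
  f (suc m)   ≤⟨ f-step m ⟩
  f m * f m   ≤⟨ *-mono-≤ ih ih ⟩
  g m * g m   ≡⟨ g-step m ⟨
  g (suc m)   ∎
  where
  open ≤-Reasoning
  ih : f m ≤ g m
  ih = squaring-≤ f g f-step g-step base m₀≤m

module _ {A : Set} where

  ∈-++-∷⁻ : ∀ {x y : A} as {bs} → y ∈ as ++ x ∷ bs → y ≢ x → y ∈ as ++ bs
  ∈-++-∷⁻ as y∈ y≢x with ∈-++⁻ as y∈
  ... | inj₁ y∈as         = ∈-++⁺ˡ y∈as
  ... | inj₂ (here y≡x)   = contradiction y≡x y≢x
  ... | inj₂ (there y∈bs) = ∈-++⁺ʳ as y∈bs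

  unique-⊆⇒length-≤ : {xs ys : List A} → Unique xs → xs ⊆ ys → length xs ≤ length ys
  unique-⊆⇒length-≤ {[]}     _             _     = z≤n
  unique-⊆⇒length-≤ {x ∷ xs} (x∉xs ∷ xs!) xs⊆ys with ∈-∃++ (xs⊆ys (here refl))
  ... | as , bs , refl = begin
    suc (length xs)             ≤⟨ s≤s (unique-⊆⇒length-≤ xs! xs⊆as++bs) ⟩
    suc (length (as ++ bs))     ≡⟨ cong suc (length-++ as) ⟩
    suc (length as + length bs) ≡⟨ +-suc (length as) (length bs) ⟨
    length as + length (x ∷ bs) ≡⟨ length-++ as ⟨
    length (as ++ x ∷ bs)       ∎
    where
    open ≤-Reasoning
    xs⊆as++bs : xs ⊆ as ++ bs
    xs⊆as++bs y∈xs = ∈-++-∷⁻ as (xs⊆ys (there y∈xs)) λ y≡x → All.lookup x∉xs y∈xs (sym y≡x)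

  length-cartesianProductWith : ∀ {B C : Set} (f : A → B → C) xs ys →
                                length (cartesianProductWith f xs ys) ≡ length xs * length ys
  length-cartesianProductWith f []       ys = refl
  length-cartesianProductWith f (x ∷ xs) ys = trans (length-++ (map (f x) ys))
    (cong₂ _+_ (length-map (f x) ys) (length-cartesianProductWith f xs ys))

  length-concatMap-≤ : ∀ {B : Set} (f : A → List B) {M} xs →
                       (∀ {x} → x ∈ xs → length (f x) ≤ M) → length (concatMap f xs) ≤ length xs * M
  length-concatMap-≤ f []       _     = z≤n
  length-concatMap-≤ f {M} (x ∷ xs) bound = begin
    length (f x ++ concatMap f xs)         ≡⟨ length-++ (f x) ⟩
    length (f x) + length (concatMap f xs) ≤⟨ +-mono-≤ (bound (here refl)) (length-concatMap-≤ f xs (λ x∈ → bound (there x∈))) ⟩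
    M + length xs * M                      ∎
    where open ≤-Reasoning

  ∈-concatMap⁺′ : ∀ {B : Set} (f : A → List B) {x xs y} → x ∈ xs → y ∈ f x → y ∈ concatMap f xs
  ∈-concatMap⁺′ f x∈ y∈ = ∈-concatMap⁺ f (lose x∈ y∈)

length-allVecs : ∀ n → length (allVecs n) ≡ 2 ^ n
length-allVecs zero    = refl
length-allVecs (suc n) = begin
  length (map (true ∷_) (allVecs n) ++ map (false ∷_) (allVecs n))
    ≡⟨ length-++ (map (true ∷_) (allVecs n)) ⟩
  length (map (true ∷_) (allVecs n)) + length (map (false ∷_) (allVecs n))
    ≡⟨ cong₂ _+_ (length-map (true ∷_) (allVecs n)) (length-map (false ∷_) (allVecs n)) ⟩
  length (allVecs n) + length (allVecs n)
    ≡⟨ cong (λ l → l + l) (length-allVecs n) ⟩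
  2 ^ n + 2 ^ n
    ≡⟨ 2*m≡m+m (2 ^ n) ⟨
  2 ^ suc n ∎
  where open ≡-Reasoning

allSubsets-unique : ∀ n → Unique (allSubsets n)
allSubsets-unique zero    = ((λ ()) All.∷ All.[]) ∷ All.[] ∷ []
allSubsets-unique (suc n) = Unique.cartesianProduct⁺ (allSubsets-unique n) (allSubsets-unique n)

length-allSubsets : ∀ n → length (allSubsets n) ≡ 2 ^ 2 ^ n
length-allSubsets zero    = refl
length-allSubsets (suc n) = begin
  length (allSubsets (suc n))                   ≡⟨ length-cartesianProductWith _,_ (allSubsets n) (allSubsets n) ⟩
  length (allSubsets n) * length (allSubsets n) ≡⟨ cong (λ l → l * l) (length-allSubsets n) ⟩
  2 ^ 2 ^ n * 2 ^ 2 ^ n                         ≡⟨ ^-double 2 (2 ^ n) ⟨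
  2 ^ 2 ^ suc n                                 ∎
  where open ≡-Reasoning

∈-filter-allSubsets : ∀ {n} {P : Pred (Subset n) 0ℓ} (P? : Decidable P) {S} → P S → S ∈ filter P? (allSubsets n)
∈-filter-allSubsets P? = ∈-filter⁺ P? (allSubsets-complete _)

countSubsets-≤ : ∀ {n} {P : Pred (Subset n) 0ℓ} (P? : Decidable P) {ys : List (Subset n)} →
                 (∀ {S} → P S → S ∈ ys) → countSubsets n P? ≤ length ys
countSubsets-≤ {n} P? covered =
  unique-⊆⇒length-≤ (Unique.filter⁺ P? (allSubsets-unique n)) λ S∈ → covered (proj₂ (∈-filter⁻ P? {xs = allSubsets n} S∈))

countSubsets-≤-image : ∀ {m n} {P : Pred (Subset n) 0ℓ} {Q : Pred (Subset m) 0ℓ}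
                       (P? : Decidable P) (Q? : Decidable Q) (g : Subset m → Subset n) →
                       (∀ {S} → P S → ∃[ A ] Q A × g A ≡ S) → countSubsets n P? ≤ countSubsets m Q?
countSubsets-≤-image {m} {P = P} P? Q? g preimage = begin
  countSubsets _ P?                         ≤⟨ countSubsets-≤ P? covered ⟩
  length (map g (filter Q? (allSubsets m))) ≡⟨ length-map g (filter Q? (allSubsets m)) ⟩
  countSubsets m Q?                         ∎
  where
  open ≤-Reasoning
  covered : ∀ {S} → P S → S ∈ map g (filter Q? (allSubsets m))
  covered PS with preimage PS
  ... | A , QA , refl = ∈-map⁺ g (∈-filter-allSubsets Q? QA)

countSubsets-≤-image₂ : ∀ {m n} {P : Pred (Subset n) 0ℓ} {Q R : Pred (Subset m) 0ℓ}
                        (P? : Decidable P) (Q? : Decidable Q) (R? : Decidable R)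
                        (g : Subset m → Subset m → Subset n) →
                        (∀ {S} → P S → ∃₂ λ A B → Q A × R B × g A B ≡ S) →
                        countSubsets n P? ≤ countSubsets m Q? * countSubsets m R?
countSubsets-≤-image₂ {m} {P = P} P? Q? R? g preimage = begin
  countSubsets _ P?                         ≤⟨ countSubsets-≤ P? covered ⟩
  length (cartesianProductWith g Qs Rs)     ≡⟨ length-cartesianProductWith g Qs Rs ⟩
  countSubsets m Q? * countSubsets m R?     ∎
  where
  open ≤-Reasoning
  Qs Rs : List (Subset m)
  Qs = filter Q? (allSubsets m)
  Rs = filter R? (allSubsets m)
  covered : ∀ {S} → P S → S ∈ cartesianProductWith g Qs Rs
  covered PS with preimage PS
  ... | A , B , QA , RB , refl =
    ∈-cartesianProductWith⁺ g (∈-filter-allSubsets Q? QA) (∈-filter-allSubsets R? RB)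

0⃗ : ∀ {n} → F₂^ n
0⃗ = replicate _ false

⊕-identityˡ : ∀ {n} (x : F₂^ n) → 0⃗ ⊕ x ≡ x
⊕-identityˡ = zipWith-identityˡ xor-identityˡ

⊕-identityʳ : ∀ {n} (x : F₂^ n) → x ⊕ 0⃗ ≡ x
⊕-identityʳ = zipWith-identityʳ xor-identityʳ

⊕-self : ∀ {n} (x : F₂^ n) → x ⊕ x ≡ 0⃗
⊕-self []      = refl
⊕-self (b ∷ x) = cong₂ _∷_ (xor-same b) (⊕-self x)

⊕-cancelˡ : ∀ {n} (t x : F₂^ n) → t ⊕ (t ⊕ x) ≡ x
⊕-cancelˡ t x = begin
  t ⊕ (t ⊕ x) ≡⟨ zipWith-assoc xor-assoc t t x ⟨
  (t ⊕ t) ⊕ x ≡⟨ cong (_⊕ x) (⊕-self t) ⟩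
  0⃗ ⊕ x       ≡⟨ ⊕-identityˡ x ⟩
  x           ∎
  where open ≡-Reasoning

⟨⟩-zeroˡ : ∀ {n} (v : F₂^ n) → ⟨ 0⃗ , v ⟩ ≡ false
⟨⟩-zeroˡ []      = refl
⟨⟩-zeroˡ (_ ∷ v) = ⟨⟩-zeroˡ v

⟨⟩-zeroʳ : ∀ {n} (x : F₂^ n) → ⟨ x , 0⃗ ⟩ ≡ false
⟨⟩-zeroʳ []          = refl
⟨⟩-zeroʳ (true ∷ x)  = ⟨⟩-zeroʳ x
⟨⟩-zeroʳ (false ∷ x) = ⟨⟩-zeroʳ x

⟨⟩-linearˡ : ∀ {n} (a b v : F₂^ n) → ⟨ a ⊕ b , v ⟩ ≡ ⟨ a , v ⟩ xor ⟨ b , v ⟩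
⟨⟩-linearˡ []       []       []       = refl
⟨⟩-linearˡ (a₀ ∷ a) (b₀ ∷ b) (v₀ ∷ v) = begin
  ((a₀ xor b₀) ∧ v₀) xor ⟨ a ⊕ b , v ⟩
    ≡⟨ cong₂ _xor_ (∧-distribʳ-xor v₀ a₀ b₀) (⟨⟩-linearˡ a b v) ⟩
  ((a₀ ∧ v₀) xor (b₀ ∧ v₀)) xor (⟨ a , v ⟩ xor ⟨ b , v ⟩)
    ≡⟨ xor-interchange (a₀ ∧ v₀) (b₀ ∧ v₀) ⟨ a , v ⟩ ⟨ b , v ⟩ ⟩
  ((a₀ ∧ v₀) xor ⟨ a , v ⟩) xor ((b₀ ∧ v₀) xor ⟨ b , v ⟩) ∎
  where open ≡-Reasoning

tabulate : ∀ {n} → (F₂^ n → Bool) → Subset n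
tabulate {zero}  f = f []
tabulate {suc n} f = tabulate (λ x → f (true ∷ x)) , tabulate (λ x → f (false ∷ x))

member-tabulate : ∀ {n} (f : F₂^ n → Bool) x → member (tabulate f) x ≡ f x
member-tabulate f []          = refl
member-tabulate f (true ∷ x)  = member-tabulate (λ y → f (true ∷ y)) x
member-tabulate f (false ∷ x) = member-tabulate (λ y → f (false ∷ y)) x

member-injective : ∀ {n} {S T : Subset n} → (∀ x → member S x ≡ member T x) → S ≡ T
member-injective {zero}  same = same []
member-injective {suc n} same =
  cong₂ _,_ (member-injective (λ x → same (true ∷ x))) (member-injective (λ x → same (false ∷ x)))

size : ∀ {n} → Subset n → ℕ
size {zero}  b         = if b then 1 else 0
size {suc n} (St , Sf) = size St + size Sf

size-tabulate-not : ∀ {n} (f : F₂^ n → Bool) → size (tabulate (λ x → not (f x))) + size (tabulate f) ≡ 2 ^ n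
size-tabulate-not {zero}  f with f []
... | true  = refl
... | false = refl
size-tabulate-not {suc n} f = begin
  (size ¬ft + size ¬ff) + (size ft + size ff) ≡⟨ +-interchange (size ¬ft) (size ¬ff) (size ft) (size ff) ⟩
  (size ¬ft + size ft) + (size ¬ff + size ff) ≡⟨ cong₂ _+_ (size-tabulate-not (λ x → f (true ∷ x))) (size-tabulate-not (λ x → f (false ∷ x))) ⟩
  2 ^ n + 2 ^ n                               ≡⟨ 2*m≡m+m (2 ^ n) ⟨
  2 ^ suc n                                   ∎
  where
  open ≡-Reasoning
  ft ff ¬ft ¬ff : Subset n
  ft  = tabulate λ x → f (true ∷ x)
  ff  = tabulate λ x → f (false ∷ x)
  ¬ft = tabulate λ x → not (f (true ∷ x))
  ¬ff = tabulate λ x → not (f (false ∷ x))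

coset : ∀ {n} → F₂^ n → Subset n
coset v = tabulate λ x → ⟨ x , v ⟩

size-coset : ∀ {n} (v : F₂^ n) → 2 * size (coset v) ≤ 2 ^ n
size-coset []          = z≤n
size-coset (true ∷ v)  = ≤-reflexive (cong (2 *_) (size-tabulate-not (λ x → ⟨ x , v ⟩)))
size-coset {suc n} (false ∷ v) = begin
  2 * (s + s)   ≡⟨ *-distribˡ-+ 2 s s ⟩
  2 * s + 2 * s ≤⟨ +-mono-≤ (size-coset v) (size-coset v) ⟩
  2 ^ n + 2 ^ n ≡⟨ 2*m≡m+m (2 ^ n) ⟨
  2 ^ suc n     ∎
  where
  open ≤-Reasoning
  s : ℕ
  s = size (coset v)

coset-invariant : ∀ {n} {v h : F₂^ n} → ⟨ h , v ⟩ ≡ false → ∀ x → x ∈ₛ coset v → (x ⊕ h) ∈ₛ coset v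
coset-invariant {v = v} {h} h⊥v x x∈ = begin
  member (coset v) (x ⊕ h) ≡⟨ member-tabulate (λ y → ⟨ y , v ⟩) (x ⊕ h) ⟩
  ⟨ x ⊕ h , v ⟩            ≡⟨ ⟨⟩-linearˡ x h v ⟩
  ⟨ x , v ⟩ xor ⟨ h , v ⟩  ≡⟨ cong₂ _xor_ (trans (sym (member-tabulate (λ y → ⟨ y , v ⟩) x)) x∈) h⊥v ⟩
  true                     ∎
  where open ≡-Reasoning

-- Counting h-free sets

_⊆ₛ_ : ∀ {n} → Subset n → Subset n → Set
S ⊆ₛ U = ∀ x → x ∈ₛ S → x ∈ₛ U

Disjoint⊕ : ∀ {n} → F₂^ n → Subset n → Subset n → Set
Disjoint⊕ h P Q = ∀ x → x ∈ₛ P → (x ⊕ h) ∈ₛ Q → ⊥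

Free : ∀ {n} → Subset n → F₂^ n → Subset n → Set
Free U h T = T ⊆ₛ U × Disjoint⊕ h T T

FreePair : ∀ {n} → Subset n → F₂^ n → Subset (suc n) → Set
FreePair U h (P , Q) = P ⊆ₛ U × (∀ x → x ∈ₛ Q → (x ⊕ h) ∈ₛ U) × Disjoint⊕ h P Q

module _ {n : ℕ} where

  private
    ∀ₓ? : {P : Pred (F₂^ n) 0ℓ} → Decidable P → Dec (∀ x → P x)
    ∀ₓ? = ∀-dec (allVecs n) allVecs-complete

  _⊆ₛ?_ : (S U : Subset n) → Dec (S ⊆ₛ U)
  S ⊆ₛ? U = ∀ₓ? λ x → ∈ₛ-dec x S →-dec ∈ₛ-dec x U

  Disjoint⊕? : ∀ h P Q → Dec (Disjoint⊕ h P Q)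
  Disjoint⊕? h P Q = ∀ₓ? λ x → ∈ₛ-dec x P →-dec (∈ₛ-dec (x ⊕ h) Q →-dec no λ ())

  Free? : ∀ U h → Decidable (Free U h)
  Free? U h T = T ⊆ₛ? U ×-dec Disjoint⊕? h T T

  FreePair? : ∀ U h → Decidable (FreePair U h)
  FreePair? U h (P , Q) =
    P ⊆ₛ? U ×-dec ∀ₓ? (λ x → ∈ₛ-dec x Q →-dec ∈ₛ-dec (x ⊕ h) U) ×-dec Disjoint⊕? h P Q

countFree : ∀ {n} → Subset n → F₂^ n → ℕ
countFree U h = countSubsets _ (Free? U h)

countFreePairs : ∀ {n} → Subset n → F₂^ n → ℕ
countFreePairs U h = countSubsets _ (FreePair? U h)

-- Each x ∈ U contributes a factor 3: (x ∈ P, x + h ∈ Q) is anything but (true, true).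
countFreePairs-≤ : ∀ {n} (U : Subset n) h → countFreePairs U h ≤ 3 ^ size U
countFreePairs-≤ {zero} true [] = countSubsets-≤ (FreePair? true []) covered
  where
  covered : ∀ {S} → FreePair true [] S → S ∈ (false , false) ∷ (true , false) ∷ (false , true) ∷ []
  covered {false , false} _                = here refl
  covered {true  , false} _                = there (here refl)
  covered {false , true}  _                = there (there (here refl))
  covered {true  , true}  (_ , _ , disjoint) = contradiction refl (disjoint [] refl)
countFreePairs-≤ {zero} false [] = countSubsets-≤ (FreePair? false []) covered
  where
  covered : ∀ {S} → FreePair false [] S → S ∈ [ (false , false) ]
  covered {false , false} _              = here refl
  covered {true  , _}     (P⊆∅ , _)      = contradiction (P⊆∅ [] refl) λ ()
  covered {false , true}  (_ , Q⊆∅ , _) = contradiction (Q⊆∅ [] refl) λ ()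
countFreePairs-≤ {suc n} (Ut , Uf) (false ∷ h) = ≤-trans
  (countSubsets-≤-image₂ (FreePair? _ _) (FreePair? Ut h) (FreePair? Uf h) merge split)
  (*-≤-^-+ (size Ut) (size Uf) (countFreePairs-≤ Ut h) (countFreePairs-≤ Uf h))
  where
  merge : Subset (suc n) → Subset (suc n) → Subset (suc (suc n))
  merge (Pt , Qt) (Pf , Qf) = (Pt , Pf) , (Qt , Qf)
  split : ∀ {S} → FreePair (Ut , Uf) (false ∷ h) S →
          ∃₂ λ A B → FreePair Ut h A × FreePair Uf h B × merge A B ≡ S
  split {(Pt , Pf) , (Qt , Qf)} (P⊆U , Q⊆U⊕h , disjoint) =
    (Pt , Qt) , (Pf , Qf) ,
    ((λ x → P⊆U (true ∷ x))  , (λ x → Q⊆U⊕h (true ∷ x))  , (λ x → disjoint (true ∷ x))) ,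
    ((λ x → P⊆U (false ∷ x)) , (λ x → Q⊆U⊕h (false ∷ x)) , (λ x → disjoint (false ∷ x))) , refl
countFreePairs-≤ {suc n} (Ut , Uf) (true ∷ h) = ≤-trans
  (countSubsets-≤-image₂ (FreePair? _ _) (FreePair? Ut h) (FreePair? Uf h) merge split)
  (*-≤-^-+ (size Ut) (size Uf) (countFreePairs-≤ Ut h) (countFreePairs-≤ Uf h))
  where
  merge : Subset (suc n) → Subset (suc n) → Subset (suc (suc n))
  merge (Pt , Qf) (Pf , Qt) = (Pt , Pf) , (Qt , Qf)
  split : ∀ {S} → FreePair (Ut , Uf) (true ∷ h) S →
          ∃₂ λ A B → FreePair Ut h A × FreePair Uf h B × merge A B ≡ S
  split {(Pt , Pf) , (Qt , Qf)} (P⊆U , Q⊆U⊕h , disjoint) =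
    (Pt , Qf) , (Pf , Qt) ,
    ((λ x → P⊆U (true ∷ x))  , (λ x → Q⊆U⊕h (false ∷ x)) , (λ x → disjoint (true ∷ x))) ,
    ((λ x → P⊆U (false ∷ x)) , (λ x → Q⊆U⊕h (true ∷ x))  , (λ x → disjoint (false ∷ x))) , refl

countFree²-≤ : ∀ {n} (U : Subset n) h → (∀ x → x ∈ₛ U → (x ⊕ h) ∈ₛ U) →
               countFree U h * countFree U h ≤ 3 ^ size U
countFree²-≤ {zero} U [] _ = ≤-trans (*-mono-≤ atMostOne atMostOne) (m^n>0 3 (size U))
  where
  covered : ∀ {T} → Free U [] T → T ∈ [ false ]
  covered {false} _             = here refl
  covered {true}  (_ , disjoint) = contradiction refl (disjoint [] refl)
  atMostOne : countFree U [] ≤ 1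
  atMostOne = countSubsets-≤ (Free? U []) covered
countFree²-≤ {suc n} (Ut , Uf) (false ∷ h) invariant = begin
  c * c                 ≤⟨ *-mono-≤ c≤ c≤ ⟩
  (ct * cf) * (ct * cf) ≡⟨ *-interchange ct cf ct cf ⟩
  (ct * ct) * (cf * cf) ≤⟨ *-≤-^-+ (size Ut) (size Uf) (countFree²-≤ Ut h (λ x → invariant (true ∷ x)))
                                   (countFree²-≤ Uf h (λ x → invariant (false ∷ x))) ⟩
  3 ^ (size Ut + size Uf) ∎
  where
  open ≤-Reasoning
  c ct cf : ℕ
  c  = countFree (Ut , Uf) (false ∷ h)
  ct = countFree Ut h
  cf = countFree Uf h
  split : ∀ {T} → Free (Ut , Uf) (false ∷ h) T → ∃₂ λ A B → Free Ut h A × Free Uf h B × (A , B) ≡ T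
  split {Tt , Tf} (T⊆U , disjoint) =
    Tt , Tf , ((λ x → T⊆U (true ∷ x))  , (λ x → disjoint (true ∷ x))) ,
              ((λ x → T⊆U (false ∷ x)) , (λ x → disjoint (false ∷ x))) , refl
  c≤ : c ≤ ct * cf
  c≤ = countSubsets-≤-image₂ (Free? _ _) (Free? Ut h) (Free? Uf h) _,_ split
-- Here x ↦ x + h swaps the two halves, so T is a free pair over Ut and, swapped, over Uf.
-- Bounding the square avoids having to show size Ut ≡ size Uf.
countFree²-≤ {suc n} (Ut , Uf) (true ∷ h) invariant =
  ≤-trans (*-mono-≤ c≤ct c≤cf) (*-≤-^-+ (size Ut) (size Uf) (countFreePairs-≤ Ut h) (countFreePairs-≤ Uf h))
  where
  c≤ct : countFree (Ut , Uf) (true ∷ h) ≤ countFreePairs Ut h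
  c≤ct = countSubsets-≤-image (Free? _ _) (FreePair? Ut h) id pairWithUt
    where
    pairWithUt : ∀ {T} → Free (Ut , Uf) (true ∷ h) T → ∃[ A ] FreePair Ut h A × A ≡ T
    pairWithUt {Tt , Tf} (T⊆U , disjoint) =
      (Tt , Tf) , ((λ x → T⊆U (true ∷ x)) , (λ x x∈ → invariant (false ∷ x) (T⊆U (false ∷ x) x∈)) ,
                   (λ x → disjoint (true ∷ x))) , refl
  c≤cf : countFree (Ut , Uf) (true ∷ h) ≤ countFreePairs Uf h
  c≤cf = countSubsets-≤-image (Free? _ _) (FreePair? Uf h) swap pairWithUf
    where
    pairWithUf : ∀ {T} → Free (Ut , Uf) (true ∷ h) T → ∃[ A ] FreePair Uf h A × swap A ≡ T
    pairWithUf {Tt , Tf} (T⊆U , disjoint) =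
      (Tf , Tt) , ((λ x → T⊆U (false ∷ x)) , (λ x x∈ → invariant (true ∷ x) (T⊆U (true ∷ x) x∈)) ,
                   (λ x → disjoint (false ∷ x))) , refl

countFree-coset-≤ : ∀ {m} {v h : F₂^ (2 + m)} → ⟨ h , v ⟩ ≡ false → countFree (coset v) h ≤ 3 ^ 2 ^ m
countFree-coset-≤ {m} {v} {h} h⊥v = m*m≤n*n⇒m≤n (begin
  countFree (coset v) h * countFree (coset v) h ≤⟨ countFree²-≤ (coset v) h (coset-invariant h⊥v) ⟩
  3 ^ size (coset v)                            ≤⟨ ^-monoʳ-≤ 3 (*-cancelˡ-≤ {size (coset v)} {2 ^ suc m} 2 (size-coset v)) ⟩
  3 ^ (2 * 2 ^ m)                               ≡⟨ ^-double 3 (2 ^ m) ⟩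
  3 ^ 2 ^ m * 3 ^ 2 ^ m                         ∎)
  where open ≤-Reasoning

-- Sumsets

outsidePerp : ∀ {n} → Subset n → F₂^ n → Subset n
outsidePerp S v = tabulate λ x → if ⟨ x , v ⟩ then member S x else false

perp∪ : ∀ {n} → F₂^ n → Subset n → Subset n
perp∪ v T = tabulate λ x → if ⟨ x , v ⟩ then member T x else true

insertZero : ∀ {n} → Subset n → Subset n
insertZero {zero}  _         = true
insertZero {suc n} (St , Sf) = St , insertZero Sf

module _ {n} {S : Subset n} {v : F₂^ n} where

  ∈-outsidePerp⁺ : ∀ x → x ∈ₛ S → ⟨ x , v ⟩ ≡ true → x ∈ₛ outsidePerp S v
  ∈-outsidePerp⁺ x x∈S x·v = begin
    member (outsidePerp S v) x                  ≡⟨ member-tabulate _ x ⟩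
    (if ⟨ x , v ⟩ then member S x else false)   ≡⟨ cong (λ b → if b then member S x else false) x·v ⟩
    member S x                                  ≡⟨ x∈S ⟩
    true                                        ∎
    where open ≡-Reasoning

  ∈-outsidePerp⁻ : ∀ x → x ∈ₛ outsidePerp S v → x ∈ₛ S × ⟨ x , v ⟩ ≡ true
  ∈-outsidePerp⁻ x x∈ with ⟨ x , v ⟩ | trans (sym (member-tabulate _ x)) x∈
  ... | true  | x∈S = x∈S , refl
  ... | false | ()

  perp∪-outsidePerp : perp⊆ v S → perp∪ v (outsidePerp S v) ≡ S
  perp∪-outsidePerp v⊥⊆S = member-injective λ x → begin
    member (perp∪ v (outsidePerp S v)) x                      ≡⟨ member-tabulate _ x ⟩
    (if ⟨ x , v ⟩ then member (outsidePerp S v) x else true)  ≡⟨ cong (λ b → if ⟨ x , v ⟩ then b else true) (member-tabulate _ x) ⟩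
    (if ⟨ x , v ⟩ then (if ⟨ x , v ⟩ then member S x else false) else true) ≡⟨ unfold x ⟩
    member S x                                                ∎
    where
    open ≡-Reasoning
    unfold : ∀ x → (if ⟨ x , v ⟩ then (if ⟨ x , v ⟩ then member S x else false) else true) ≡ member S x
    unfold x with ⟨ x , v ⟩ in x·v
    ... | true  = refl
    ... | false = sym (v⊥⊆S x x·v)

0⃗∈insertZero : ∀ {n} (T : Subset n) → 0⃗ ∈ₛ insertZero T
0⃗∈insertZero {zero}  _        = refl
0⃗∈insertZero {suc n} (_ , Tf) = 0⃗∈insertZero Tf

⊆-insertZero : ∀ {n} (T : Subset n) → T ⊆ₛ insertZero T
⊆-insertZero {zero}  _         []          x∈ = refl
⊆-insertZero {suc n} (Tt , Tf) (true ∷ x)  x∈ = x∈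
⊆-insertZero {suc n} (Tt , Tf) (false ∷ x) x∈ = ⊆-insertZero Tf x x∈

∈-insertZero⁻ : ∀ {n} (T : Subset n) x → x ∈ₛ insertZero T → x ≡ 0⃗ ⊎ x ∈ₛ T
∈-insertZero⁻ {zero}  _         []          _  = inj₁ refl
∈-insertZero⁻ {suc n} (Tt , Tf) (true ∷ x)  x∈ = inj₂ x∈
∈-insertZero⁻ {suc n} (Tt , Tf) (false ∷ x) x∈ with ∈-insertZero⁻ Tf x x∈
... | inj₁ refl = inj₁ refl
... | inj₂ x∈Tf = inj₂ x∈Tf

module _ {n} {S : Subset n} {v : F₂^ n} (v⊥⊆S : perp⊆ v S) where

  private
    T : Subset n
    T = outsidePerp S v

    A : Subset n
    A = insertZero T

    A⊆S : A ⊆ₛ S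
    A⊆S x x∈A with ∈-insertZero⁻ T x x∈A
    ... | inj₁ refl = v⊥⊆S 0⃗ (⟨⟩-zeroˡ v)
    ... | inj₂ x∈T  = proj₁ (∈-outsidePerp⁻ x x∈T)

    meet? : ∀ h → Dec (∃[ t ] t ∈ₛ T × (t ⊕ h) ∈ₛ T)
    meet? h = ∃-dec (allVecs n) allVecs-complete λ t → ∈ₛ-dec t T ×-dec ∈ₛ-dec (t ⊕ h) T

  In𝒮-if-translates-meet : (∀ h → ⟨ h , v ⟩ ≡ false → ∃[ t ] t ∈ₛ T × (t ⊕ h) ∈ₛ T) → In𝒮 S
  In𝒮-if-translates-meet meet = A , λ x → mk⇔ (S⊆A+A x) (A+A⊆S x)
    where
    S⊆A+A : ∀ x → x ∈ₛ S → x ∈A+A A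
    S⊆A+A x x∈S with ⟨ x , v ⟩ in x·v
    ... | true  = 0⃗ , x , 0⃗∈insertZero T , ⊆-insertZero T x (∈-outsidePerp⁺ x x∈S x·v) , ⊕-identityˡ x
    ... | false with meet x x·v
    ... | t , t∈T , t⊕x∈T = t , t ⊕ x , ⊆-insertZero T t t∈T , ⊆-insertZero T (t ⊕ x) t⊕x∈T , ⊕-cancelˡ t x

    A+A⊆S : ∀ x → x ∈A+A A → x ∈ₛ S
    A+A⊆S _ (a , b , a∈A , b∈A , refl) with ∈-insertZero⁻ T a a∈A | ∈-insertZero⁻ T b b∈A
    ... | inj₁ refl | _         = subst (_∈ₛ S) (sym (⊕-identityˡ b)) (A⊆S b b∈A)
    ... | inj₂ _    | inj₁ refl = subst (_∈ₛ S) (sym (⊕-identityʳ a)) (A⊆S a a∈A)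
    ... | inj₂ a∈T  | inj₂ b∈T  = v⊥⊆S (a ⊕ b) (trans (⟨⟩-linearˡ a b v)
      (cong₂ _xor_ (proj₂ (∈-outsidePerp⁻ a a∈T)) (proj₂ (∈-outsidePerp⁻ b b∈T))))

  free-direction-if-∉𝒮 : ¬ In𝒮 S → ∃[ h ] ⟨ h , v ⟩ ≡ false × Free (coset v) h T
  free-direction-if-∉𝒮 S∉𝒮 with ∃-dec (allVecs n) allVecs-complete (λ h → (⟨ h , v ⟩ ≟B false) ×-dec ¬? (meet? h))
  ... | yes (h , h⊥v , ¬meet) = h , h⊥v , T⊆coset , λ x x∈T x⊕h∈T → ¬meet (x , x∈T , x⊕h∈T)
    where
    T⊆coset : T ⊆ₛ coset v
    T⊆coset x x∈T = trans (member-tabulate (λ y → ⟨ y , v ⟩) x) (proj₂ (∈-outsidePerp⁻ x x∈T))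
  ... | no ∄free = contradiction (In𝒮-if-translates-meet λ h h⊥v →
          decidable-stable (meet? h) λ ¬meet → ∄free (h , h⊥v , ¬meet)) S∉𝒮

-- Counting ℋₙ ∖ 𝒮ₙ and ℋₙ

perp : ∀ {n} → F₂^ n → List (F₂^ n)
perp {n} v = filter (λ h → ⟨ h , v ⟩ ≟B false) (allVecs n)

perp∪-free : ∀ {n} → F₂^ n → F₂^ n → List (Subset n)
perp∪-free {n} v h = map (perp∪ v) (filter (Free? (coset v) h) (allSubsets n))

encodings : ∀ n → List (Subset n)
encodings n = concatMap (λ v → concatMap (perp∪-free v) (perp v)) (allVecs n)

ℋ∖𝒮⊆encodings : ∀ {n} {S : Subset n} → Inℋ∖𝒮 S → S ∈ encodings n
ℋ∖𝒮⊆encodings {n} {S} ((v , v⊥⊆S) , S∉𝒮) with free-direction-if-∉𝒮 v⊥⊆S S∉𝒮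
... | h , h⊥v , T-free =
  ∈-concatMap⁺′ _ (allVecs-complete v) (∈-concatMap⁺′ (perp∪-free v) h∈perp
    (subst (_∈ perp∪-free v h) (perp∪-outsidePerp v⊥⊆S)
      (∈-map⁺ (perp∪ v) (∈-filter-allSubsets (Free? (coset v) h) T-free))))
  where
  h∈perp : h ∈ perp v
  h∈perp = ∈-filter⁺ (λ h → ⟨ h , v ⟩ ≟B false) (allVecs-complete h) h⊥v

#ℋ∖𝒮-≤ : ∀ n {M} → (∀ {v h : F₂^ n} → ⟨ h , v ⟩ ≡ false → countFree (coset v) h ≤ M) →
         #ℋ∖𝒮 n ≤ 2 ^ n * (2 ^ n * M)
#ℋ∖𝒮-≤ n {M} bound = begin
  #ℋ∖𝒮 n                           ≤⟨ countSubsets-≤ (Inℋ∖𝒮? {n}) ℋ∖𝒮⊆encodings ⟩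
  length (encodings n)             ≤⟨ length-concatMap-≤ _ (allVecs n) (λ {v} _ → per-v v) ⟩
  length (allVecs n) * (2 ^ n * M) ≡⟨ cong (_* (2 ^ n * M)) (length-allVecs n) ⟩
  2 ^ n * (2 ^ n * M)              ∎
  where
  open ≤-Reasoning
  per-h : ∀ {v h} → h ∈ perp v → length (perp∪-free v h) ≤ M
  per-h {v} {h} h∈ = ≤-trans (≤-reflexive (length-map (perp∪ v) (filter (Free? (coset v) h) (allSubsets n))))
                             (bound {v} {h} (proj₂ (∈-filter⁻ (λ h → ⟨ h , v ⟩ ≟B false) {xs = allVecs n} h∈)))
  per-v : ∀ v → length (concatMap (perp∪-free v) (perp v)) ≤ 2 ^ n * M
  per-v v = ≤-trans (length-concatMap-≤ (perp∪-free v) (perp v) per-h)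
                    (*-monoˡ-≤ M (≤-trans (length-filter _ (allVecs n)) (≤-reflexive (length-allVecs n))))

#ℋ-≥ : ∀ m → 2 ^ 2 ^ m ≤ #ℋ (suc m)
#ℋ-≥ m = begin
  2 ^ 2 ^ m                             ≡⟨ length-allSubsets m ⟨
  length (allSubsets m)                 ≡⟨ length-map (_, full) (allSubsets m) ⟨
  length (map (_, full) (allSubsets m)) ≤⟨ unique-⊆⇒length-≤ (Unique.map⁺ (cong proj₁) (allSubsets-unique m)) ⊆ℋ ⟩
  #ℋ (suc m)                            ∎
  where
  open ≤-Reasoning
  full : Subset m
  full = tabulate λ _ → true
  e₀⊥⊆ : ∀ St → perp⊆ (true ∷ 0⃗) (St , full)
  e₀⊥⊆ St (true ∷ x)  x·e₀ = contradiction (trans (cong not (sym (⟨⟩-zeroʳ x))) x·e₀) λ ()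
  e₀⊥⊆ St (false ∷ x) _    = member-tabulate (λ _ → true) x
  ⊆ℋ : map (_, full) (allSubsets m) ⊆ filter Inℋ? (allSubsets (suc m))
  ⊆ℋ S∈ with ∈-map⁻ (_, full) S∈
  ... | St , _ , refl = ∈-filter-allSubsets Inℋ? (true ∷ 0⃗ , e₀⊥⊆ St)

polynomial*3^2^m≤4^2^m : ∀ {m} → 6 ≤ m → 2 ^ m * (2 ^ (2 + m) * (2 ^ (2 + m) * 3 ^ 2 ^ m)) ≤ 2 ^ 2 ^ suc m
polynomial*3^2^m≤4^2^m 6≤m =
  squaring-≤ f (λ m → 2 ^ 2 ^ suc m) f-step (λ m → ^-double 2 (2 ^ suc m)) base (≤⇒≤′ 6≤m)
  where
  f : ℕ → ℕ
  f m = 2 ^ m * (2 ^ (2 + m) * (2 ^ (2 + m) * 3 ^ 2 ^ m))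
  -- 2²² · 3⁶⁴ ≤ 2¹²⁸, checked by evaluation; m = 5 already fails.
  base : f 6 ≤ 2 ^ 2 ^ 7
  base = ≤ᵇ⇒≤ (f 6) (2 ^ 2 ^ 7) tt
  -- With a = 2 ^ m, f m = 16 a³ 3^a, so f m * f m = f (suc m) * 2a³.
  f-step : ∀ m → f (suc m) ≤ f m * f m
  f-step m = begin
    f (suc m)      ≡⟨ cong (λ Q → 2 * a * (2 * (2 * (2 * a)) * (2 * (2 * (2 * a)) * Q))) (^-double 3 a) ⟩
    L              ≡⟨ *-identityʳ L ⟨
    L * 1          ≤⟨ *-monoʳ-≤ L (*-mono-≤ {1} {2} (s≤s z≤n) (*-mono-≤ 1≤a (*-mono-≤ 1≤a 1≤a))) ⟩
    L * (2 * (a * (a * a))) ≡⟨ polynomial a (3 ^ a) ⟩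
    f m * f m      ∎
    where
    open ≤-Reasoning
    a : ℕ
    a = 2 ^ m
    1≤a : 1 ≤ a
    1≤a = m^n>0 2 m
    L : ℕ
    L = 2 * a * (2 * (2 * (2 * a)) * (2 * (2 * (2 * a)) * (3 ^ a * 3 ^ a)))
    polynomial : ∀ a P →
      2 * a * (2 * (2 * (2 * a)) * (2 * (2 * (2 * a)) * (P * P))) * (2 * (a * (a * a)))
      ≡ (a * (2 * (2 * a) * (2 * (2 * a) * P))) * (a * (2 * (2 * a) * (2 * (2 * a) * P)))
    polynomial = solve-∀

theorem4p2 : ∀ (k : ℕ) → ∃[ N ] (∀ (n : ℕ) → N ≤ n → k * #ℋ∖𝒮 n ≤ #ℋ n)
theorem4p2 k = 8 + k , bound
  where
  open ≤-Reasoning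
  bound : ∀ n → 8 + k ≤ n → k * #ℋ∖𝒮 n ≤ #ℋ n
  bound (suc (suc m)) (s≤s (s≤s 6+k≤m)) = begin
    k * #ℋ∖𝒮 (2 + m)                                     ≤⟨ *-monoʳ-≤ k (#ℋ∖𝒮-≤ (2 + m) λ {v} {h} → countFree-coset-≤ {m} {v} {h}) ⟩
    k * (2 ^ (2 + m) * (2 ^ (2 + m) * 3 ^ 2 ^ m))        ≤⟨ *-monoˡ-≤ _ k≤2^m ⟩
    2 ^ m * (2 ^ (2 + m) * (2 ^ (2 + m) * 3 ^ 2 ^ m))    ≤⟨ polynomial*3^2^m≤4^2^m (≤-trans (m≤m+n 6 k) 6+k≤m) ⟩
    2 ^ 2 ^ suc m                                        ≤⟨ #ℋ-≥ (suc m) ⟩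
    #ℋ (2 + m)                                           ∎
    where
    k≤2^m : k ≤ 2 ^ m
    k≤2^m = ≤-trans (m≤n+m k 6) (≤-trans 6+k≤m (<⇒≤ (n<2^n m)))
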